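{- Let $n\ge d$, let $v\in\mathbb Z_{>0}^d$ with $k=\sum_i v_i<n$, let $\mathcal M=(M_\sigma)$ be a linkage $(n,d)$-tope field of type $v$, and let $\tau\subseteq L$ with $|\tau|=k+1$, with linkage covector $C=C_\tau$. Then, for each $r_i\in R$, exactly $v_i+1$ nodes are adjacent to $r_i$ in $C$. Furthermore, for each $\ell_j\in\tau$, $C$ contains a unique tope with right degree vector $v$ in which $\ell_j$ is isolated, namely the tope $M_{\tau\setminus\{\ell_j\}}$ of the tope field. Here "tope in which $\ell_j$ is isolated" means a tope with left degree vector $e_{\tau\setminus\{\ell_j\}}$.
   Context: $L=\{\ell_1,\dots,\ell_n\}$, $R=\{r_1,\dots,r_d\}$; graphs are identified with edge sets. A tope is a bipartite graph whose left degree vector (degrees of the $\ell_j$) is $e_\sigma$ for some $\sigma\subseteq L$ and whose right degree vector (degrees of the $r_i$) has positive entries. An $(n,d)$-tope field of type $v$ with thickness $k=\sum v_i\le n$ is a family $(M_\sigma)$ with, for each $k$-subset $\sigma\subseteq L$, one tope $M_\sigma$ with left degree vector $e_\sigma$ and right degree vector $v$. It is linkage if for every $(k+1)$-subset $\tau\subseteq L$ the union $C_\tau$ of the $M_\sigma$, $\sigma\subset\tau$, $|\sigma|=k$, is a tree; $C_\tau$ is called a linkage covector. -}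

module Defs where

open import Data.Nat using (ℕ; zero; suc; _≤_; _<_)
open import Data.Bool using (Bool; true; false; if_then_else_; _∧_)
open import Data.Bool.ListAction using (any)
open import Data.Fin using (Fin)
open import Data.Fin.Subset using (Subset; _∈_; _⊆_; ∣_∣)
open import Data.Fin.Subset.Properties using (_⊆?_)
open import Data.Vec using (Vec; []; _∷_; tabulate; lookup)
import Data.Vec as Vec
open import Data.List using (List; []; _∷_; length; map; _++_)
open import Data.List.Relation.Unary.Unique.Propositional using (Unique)
open import Data.Sum using (_⊎_; inj₁; inj₂)
open import Data.Product using (Σ; _×_; ∃)
open import Data.Empty using (⊥)
open import Data.Unit using (⊤)
open import Relation.Nullary using (¬_; does)
open import Relation.Binary.PropositionalEquality using (_≡_)
import Data.Nat as ℕ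

-- A bipartite graph between L = {ℓ_1..ℓ_n} (Fin n) and R = {r_1..r_d} (Fin d),
-- identified with its edge set: G j i ≡ true iff ℓ_j r_i is an edge.
Graph : ℕ → ℕ → Set
Graph n d = Fin n → Fin d → Bool

degL : ∀ {n d} → Graph n d → Fin n → ℕ
degL G j = ∣ tabulate (G j) ∣

degR : ∀ {n d} → Graph n d → Fin d → ℕ
degR G i = ∣ tabulate (λ j → G j i) ∣

HasLeftDegree : ∀ {n d} → Graph n d → Subset n → Set
HasLeftDegree G σ = ∀ j → degL G j ≡ (if lookup σ j then 1 else 0)

HasRightDegree : ∀ {n d} → Graph n d → (Fin d → ℕ) → Set
HasRightDegree G w = ∀ i → degR G i ≡ w i

IsTope : ∀ {n d} → Graph n d → Subset n → (Fin d → ℕ) → Set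
IsTope G σ w = HasLeftDegree G σ × HasRightDegree G w × (∀ i → 0 < w i)

_⊑_ : ∀ {n d} → Graph n d → Graph n d → Set
G ⊑ H = ∀ j i → G j i ≡ true → H j i ≡ true

Vertex : ℕ → ℕ → Set
Vertex n d = Fin n ⊎ Fin d

Adj : ∀ {n d} → Graph n d → Vertex n d → Vertex n d → Set
Adj G (inj₁ j) (inj₁ j′) = ⊥
Adj G (inj₁ j) (inj₂ i) = G j i ≡ true
Adj G (inj₂ i) (inj₁ j) = G j i ≡ true
Adj G (inj₂ i) (inj₂ i′) = ⊥

IsNode : ∀ {n d} → Graph n d → Vertex n d → Set
IsNode G x = ∃ λ y → Adj G x y

data Walk {n d} (G : Graph n d) : Vertex n d → Vertex n d → Set where
  here : ∀ {x} → Walk G x x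
  step : ∀ {x y z} → Adj G x y → Walk G y z → Walk G x z

Connected : ∀ {n d} → Graph n d → Set
Connected G = ∀ x y → IsNode G x → IsNode G y → Walk G x y

Chain : ∀ {n d} → Graph n d → Vertex n d → List (Vertex n d) → Vertex n d → Set
Chain G a [] b = Adj G a b
Chain G a (y ∷ ys) b = Adj G a y × Chain G y ys b

IsCycle : ∀ {n d} → Graph n d → List (Vertex n d) → Set
IsCycle G [] = ⊥
IsCycle G (x ∷ xs) = 3 ≤ length (x ∷ xs) × Unique (x ∷ xs) × Chain G x xs x

Acyclic : ∀ {n d} → Graph n d → Set
Acyclic G = ∀ cs → ¬ IsCycle G cs

IsTree : ∀ {n d} → Graph n d → Set
IsTree G = Connected G × Acyclic G

allSubsets : ∀ n → List (Subset n)
allSubsets zero = [] ∷ []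
allSubsets (suc n) = map (true ∷_) (allSubsets n) ++ map (false ∷_) (allSubsets n)

sumV : ∀ {d} → (Fin d → ℕ) → ℕ
sumV v = Vec.sum (tabulate v)

-- an (n,d)-tope field of type v (thickness k = sumV v ≤ n): a family indexed by
-- subsets σ of L, of which only the k-subsets matter
IsTopeField : ∀ {n d} → (v : Fin d → ℕ) → (Subset n → Graph n d) → Set
IsTopeField {n} v M = sumV v ≤ n × (∀ (σ : Subset n) → ∣ σ ∣ ≡ sumV v → IsTope (M σ) σ v)

covector : ∀ {n d} → (k : ℕ) → (Subset n → Graph n d) → Subset n → Graph n d
covector {n} k M τ j i =
  any (λ σ → does (σ ⊆? τ) ∧ (∣ σ ∣ ℕ.≡ᵇ k) ∧ M σ j i) (allSubsets n)

IsLinkage : ∀ {n d} → (v : Fin d → ℕ) → (Subset n → Graph n d) → Set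
IsLinkage {n} v M = ∀ (τ : Subset n) → ∣ τ ∣ ≡ suc (sumV v) → IsTree (covector (sumV v) M τ)

module Submission where

-- Every r_i has degree ≥ v_i + 1 in C: choose ℓ_a adjacent to r_i in
-- some tope of the field contained in C; then M_{τ∖ℓ_a} ⊆ C has v_i edges at r_i,
-- none of them at ℓ_a.  Conversely, a forest has fewer edges than nodes, and C
-- has at most (k+1) + d nodes, so Σ_i deg_C(r_i) ≤ k + d = Σ_i (v_i + 1).  Hence
-- all the inequalities are equalities.
--
-- Two subgraphs of a forest with the same degree at every vertex
-- coincide: every degree of their symmetric difference is even, and a nonempty
-- graph without vertices of degree one contains a cycle.

open import Defs
open import Data.Nat using (ℕ; zero; suc; _+_; _*_; _≤_; _<_; z≤n; s≤s; _≡ᵇ_)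
open import Data.Nat.Properties
open import Algebra.Properties.CommutativeSemigroup +-commutativeSemigroup using (interchange)
open import Data.Bool using (Bool; true; false; _∧_; _xor_; if_then_else_)
open import Data.Bool.Properties using (T-≡; T-∧)
open import Data.Fin using (Fin; zero; suc; join; splitAt)
import Data.Fin.Properties as Fin
open import Data.Fin.Subset using (Subset; ∣_∣; _∈_; _-_; _⊆_; ⁅_⁆)
open import Data.Fin.Subset.Properties using (_⊆?_; p─q⊆p; p─⊥≡p)
open import Data.Vec using ([]; _∷_; tabulate; lookup)
open import Data.Vec.Properties using (tabulate∘lookup; []=⇒lookup; lookup⇒[]=)
open import Data.List using (List; []; _∷_; length)
import Data.List as List
open import Data.List.Relation.Unary.All using (All; []; _∷_)
import Data.List.Relation.Unary.All as All
open import Data.List.Relation.Unary.All.Properties using (¬Any⇒All¬)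
open import Data.List.Relation.Unary.Any using (here; there; satisfied)
open import Data.List.Relation.Unary.Any.Properties using (any⁺; any⁻)
open import Data.List.Relation.Unary.AllPairs using ([]; _∷_)
open import Data.List.Relation.Unary.Linked using (Linked; [-]; _∷_) renaming (head to linked-head)
open import Data.List.Relation.Unary.Unique.Propositional using (Unique)
open import Data.List.Membership.Propositional using (lose) renaming (_∈_ to _∈ₗ_)
open import Data.List.Membership.Propositional.Properties using (∈-map⁺; ∈-++⁺ˡ; ∈-++⁺ʳ; ∈-lookup)
open import Data.Sum using (_⊎_; inj₁; inj₂)
open import Data.Sum.Properties using (≡-dec; inj₁-injective; inj₂-injective)
open import Data.Product using (_×_; _,_; ∃; proj₁; proj₂)
open import Data.Empty using (⊥-elim)
open import Function using (_∘_; Equivalence)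
open import Relation.Nullary using (Dec; yes; no; does; ¬?; contradiction)
open import Relation.Nullary.Decidable using (_×-dec_; dec-true)
open import Relation.Binary.PropositionalEquality

open Equivalence using (to; from)

sumF : ∀ {m} → (Fin m → ℕ) → ℕ
sumF {zero} a = 0
sumF {suc m} a = a zero + sumF (a ∘ suc)

sumF-cong : ∀ {m} {a b : Fin m → ℕ} → (∀ x → a x ≡ b x) → sumF a ≡ sumF b
sumF-cong {zero} e = refl
sumF-cong {suc m} e = cong₂ _+_ (e zero) (sumF-cong (e ∘ suc))

sumF-mono : ∀ {m} {a b : Fin m → ℕ} → (∀ x → a x ≤ b x) → sumF a ≤ sumF b
sumF-mono {zero} le = z≤n
sumF-mono {suc m} le = +-mono-≤ (le zero) (sumF-mono (le ∘ suc))

sumF-mono-< : ∀ {m} {a b : Fin m → ℕ} → (∀ x → a x ≤ b x) → ∀ x → a x < b x → sumF a < sumF b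
sumF-mono-< {suc m} le zero lt = +-mono-<-≤ lt (sumF-mono (le ∘ suc))
sumF-mono-< {suc m} le (suc x) lt = +-mono-≤-< (le zero) (sumF-mono-< (le ∘ suc) x lt)

sumF-bump : ∀ {m} {a b : Fin m → ℕ} x → suc (a x) ≡ b x → (∀ y → y ≢ x → a y ≡ b y) →
            suc (sumF a) ≡ sumF b
sumF-bump {suc m} zero e rest = cong₂ _+_ e (sumF-cong (λ y → rest (suc y) λ ()))
sumF-bump {suc m} {a} (suc x) e rest =
  trans (sym (+-suc (a zero) _))
        (cong₂ _+_ (rest zero λ ()) (sumF-bump x e (λ y y≢x → rest (suc y) (y≢x ∘ Fin.suc-injective))))

sumF-zero : ∀ {m} → sumF {m} (λ _ → 0) ≡ 0
sumF-zero {zero} = refl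
sumF-zero {suc m} = sumF-zero {m}

sumF-+ : ∀ {m} (a b : Fin m → ℕ) → sumF (λ x → a x + b x) ≡ sumF a + sumF b
sumF-+ {zero} a b = refl
sumF-+ {suc m} a b =
  trans (cong (a zero + b zero +_) (sumF-+ (a ∘ suc) (b ∘ suc))) (interchange (a zero) (b zero) _ _)

sumF-suc : ∀ {m} (a : Fin m → ℕ) → sumF (λ x → suc (a x)) ≡ sumF a + m
sumF-suc {zero} a = refl
sumF-suc {suc m} a = begin
  suc (a zero + sumF (λ x → suc (a (suc x)))) ≡⟨ cong (λ s → suc (a zero + s)) (sumF-suc (a ∘ suc)) ⟩
  suc (a zero + (sumF (a ∘ suc) + m))         ≡⟨ cong suc (+-assoc (a zero) _ m) ⟨
  suc (a zero + sumF (a ∘ suc) + m)           ≡⟨ +-suc _ m ⟨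
  a zero + sumF (a ∘ suc) + suc m             ∎
  where open ≡-Reasoning

sumF-witness : ∀ {m} (a : Fin m → ℕ) → 0 < sumF a → ∃ λ x → 0 < a x
sumF-witness {suc m} a pos with a zero in a₀
... | suc _ = zero , subst (0 <_) (sym a₀) (s≤s z≤n)
... | zero with sumF-witness (a ∘ suc) pos
...   | x , ax>0 = suc x , ax>0

sumF-tight : ∀ {m} {a b : Fin m → ℕ} → (∀ x → b x ≤ a x) → sumF a ≤ sumF b → ∀ x → a x ≡ b x
sumF-tight {a = a} {b} b≤a Σa≤Σb x with a x ≤? b x
... | yes ax≤bx = ≤-antisym ax≤bx (b≤a x)
... | no ax≰bx = contradiction Σa≤Σb (<⇒≱ (sumF-mono-< b≤a x (≰⇒> ax≰bx)))

sumV≡sumF : ∀ {d} (v : Fin d → ℕ) → sumV v ≡ sumF v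
sumV≡sumF {zero} v = refl
sumV≡sumF {suc d} v = cong (v zero +_) (sumV≡sumF (v ∘ suc))

χ : Bool → ℕ
χ true = 1
χ false = 0

χ-mono : ∀ {a b} → (a ≡ true → b ≡ true) → χ a ≤ χ b
χ-mono {false} _ = z≤n
χ-mono {true} a⇒b rewrite a⇒b refl = s≤s z≤n

count : ∀ {m} → (Fin m → Bool) → ℕ
count f = sumF (χ ∘ f)

count-tabulate : ∀ {m} (f : Fin m → Bool) → ∣ tabulate f ∣ ≡ count f
count-tabulate {zero} f = refl
count-tabulate {suc m} f with f zero
... | true = cong suc (count-tabulate (f ∘ suc))
... | false = count-tabulate (f ∘ suc)

count-lookup : ∀ {m} (p : Subset m) → ∣ p ∣ ≡ count (lookup p)
count-lookup p = trans (cong ∣_∣ (sym (tabulate∘lookup p))) (count-tabulate (lookup p))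

count-all : ∀ {m} → count {m} (λ _ → true) ≡ m
count-all {zero} = refl
count-all {suc m} = cong suc (count-all {m})

count-pos : ∀ {m} {f : Fin m → Bool} x → f x ≡ true → 0 < count f
count-pos {f = f} zero fx rewrite fx = s≤s z≤n
count-pos {f = f} (suc x) fx = ≤-trans (count-pos x fx) (m≤n+m _ (χ (f zero)))

count-witness : ∀ {m} (f : Fin m → Bool) → 0 < count f → ∃ λ x → f x ≡ true
count-witness f pos with sumF-witness (χ ∘ f) pos
... | x , χfx>0 with f x in fx
...   | true = x , fx

count-second : ∀ {m} {f : Fin m → Bool} x → f x ≡ true → count f ≢ 1 →
               ∃ λ y → y ≢ x × f y ≡ true
count-second {m} {f} x fx count≢1 with Fin.any? (λ y → ¬? (y Fin.≟ x) ×-dec (f y Data.Bool.≟ true))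
... | yes found = found
... | no none = contradiction
  (trans (sym (sumF-bump x (cong χ (sym fx)) nothing-else)) (cong suc (sumF-zero {m}))) count≢1
  where
  nothing-else : ∀ y → y ≢ x → 0 ≡ χ (f y)
  nothing-else y y≢x with f y in fy
  ... | true = contradiction (y , y≢x , fy) none
  ... | false = refl

-- The number of indices where f and g differ has the parity of count f + count g;
-- in particular it is never 1 when the two counts agree.
count-xor≢1 : ∀ {m} (f g : Fin m → Bool) → count f ≡ count g → count (λ x → f x xor g x) ≢ 1
count-xor≢1 f g same one = even≢odd (count g) (count (λ x → f x ∧ g x)) (begin
  2 * count g                                      ≡⟨ cong (count g +_) (+-identityʳ _) ⟩
  count g + count g                                ≡⟨ cong (_+ count g) same ⟨
  count f + count g                                ≡⟨ sumF-+ (χ ∘ f) (χ ∘ g) ⟨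
  sumF (λ x → χ (f x) + χ (g x))                   ≡⟨ sumF-cong (λ x → χ-split (f x) (g x)) ⟩
  sumF (λ x → χ (f x xor g x) + (χ (f x ∧ g x) + χ (f x ∧ g x)))
    ≡⟨ sumF-+ (λ x → χ (f x xor g x)) _ ⟩
  count (λ x → f x xor g x) + sumF (λ x → χ (f x ∧ g x) + χ (f x ∧ g x))
    ≡⟨ cong₂ _+_ one (sumF-+ (λ x → χ (f x ∧ g x)) _) ⟩
  suc (count (λ x → f x ∧ g x) + count (λ x → f x ∧ g x))
    ≡⟨ cong (λ t → suc (count (λ x → f x ∧ g x) + t)) (+-identityʳ _) ⟨
  suc (2 * count (λ x → f x ∧ g x)) ∎)
  where
  open ≡-Reasoning
  χ-split : ∀ a b → χ a + χ b ≡ χ (a xor b) + (χ (a ∧ b) + χ (a ∧ b))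
  χ-split true true = refl
  χ-split true false = refl
  χ-split false true = refl
  χ-split false false = refl

-- occupied a is 1 if a is positive and 0 otherwise; summed over degrees it counts nodes.
occupied : ℕ → ℕ
occupied zero = 0
occupied (suc _) = 1

occupied-mono : ∀ {a b} → a ≤ b → occupied a ≤ occupied b
occupied-mono {zero} _ = z≤n
occupied-mono {suc a} {suc b} _ = s≤s z≤n

occupied-sum-mono : ∀ {m} {a b : Fin m → ℕ} → (∀ x → a x ≤ b x) → sumF (occupied ∘ a) ≤ sumF (occupied ∘ b)
occupied-sum-mono a≤b = sumF-mono (occupied-mono ∘ a≤b)

occupied-sum-< : ∀ {m} {a b : Fin m → ℕ} → (∀ x → a x ≤ b x) → ∀ x → a x ≡ 0 → b x ≡ 1 →
                 sumF (occupied ∘ a) < sumF (occupied ∘ b)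
occupied-sum-< a≤b x ax≡0 bx≡1 =
  sumF-mono-< (occupied-mono ∘ a≤b) x (subst₂ (λ s t → occupied s < occupied t) (sym ax≡0) (sym bx≡1) (s≤s z≤n))

occupied-sum-pos : ∀ {m} {a : Fin m → ℕ} x → 0 < a x → 0 < sumF (occupied ∘ a)
occupied-sum-pos {m} {a} x ax>0 =
  subst (_< sumF (occupied ∘ a)) (sumF-zero {m}) (sumF-mono-< (λ _ → z≤n) x (occupied-pos ax>0))
  where
  occupied-pos : ∀ {b} → 0 < b → 0 < occupied b
  occupied-pos {suc _} _ = s≤s z≤n

occupied-sum-≤ : ∀ {m} {a : Fin m → ℕ} (p : Fin m → Bool) → (∀ x → 0 < a x → p x ≡ true) →
                 sumF (occupied ∘ a) ≤ count p
occupied-sum-≤ {a = a} p support = sumF-mono bound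
  where
  bound : ∀ x → occupied (a x) ≤ χ (p x)
  bound x with a x in ax
  ... | zero = z≤n
  ... | suc _ rewrite support x (subst (0 <_) (sym ax) (s≤s z≤n)) = s≤s z≤n

unique-lookup : ∀ {A : Set} {xs : List A} → Unique xs → ∀ {a b} → a Data.Fin.< b →
                List.lookup xs a ≢ List.lookup xs b
unique-lookup (x∉xs ∷ _) {zero} {suc b} _ = All.lookup x∉xs (∈-lookup b)
unique-lookup (_ ∷ u) {suc a} {suc b} (s≤s a<b) = unique-lookup u a<b

module Graphs {n d : ℕ} where

  V : Set
  V = Vertex n d

  _≟V_ : (x y : V) → Dec (x ≡ y)
  _≟V_ = ≡-dec Fin._≟_ Fin._≟_

  open import Data.List.Membership.DecPropositional _≟V_ using (_∈?_)

  degL≡count : ∀ (H : Graph n d) j → degL H j ≡ count (H j)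
  degL≡count H j = count-tabulate (H j)

  degR≡count : ∀ (H : Graph n d) i → degR H i ≡ count (λ j → H j i)
  degR≡count H i = count-tabulate (λ j → H j i)

  degL-mono : ∀ {G H : Graph n d} → G ⊑ H → ∀ j → degL G j ≤ degL H j
  degL-mono {G} {H} G⊑H j rewrite degL≡count G j | degL≡count H j = sumF-mono (λ i → χ-mono (G⊑H j i))

  degR-mono : ∀ {G H : Graph n d} → G ⊑ H → ∀ i → degR G i ≤ degR H i
  degR-mono {G} {H} G⊑H i rewrite degR≡count G i | degR≡count H i = sumF-mono (λ j → χ-mono (G⊑H j i))

  degR-mono-< : ∀ {G H : Graph n d} → G ⊑ H → ∀ j i → G j i ≡ false → H j i ≡ true → degR G i < degR H i
  degR-mono-< {G} {H} G⊑H j i Gji Hji rewrite degR≡count G i | degR≡count H i =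
    sumF-mono-< (λ j′ → χ-mono (G⊑H j′ i)) j (subst₂ (λ a b → χ a < χ b) (sym Gji) (sym Hji) (s≤s z≤n))

  degL-pos : ∀ (H : Graph n d) j i → H j i ≡ true → 0 < degL H j
  degL-pos H j i e = subst (0 <_) (sym (degL≡count H j)) (count-pos i e)

  degR-pos : ∀ (H : Graph n d) j i → H j i ≡ true → 0 < degR H i
  degR-pos H j i e = subst (0 <_) (sym (degR≡count H i)) (count-pos j e)

  degR-witness : ∀ (H : Graph n d) i → 0 < degR H i → ∃ λ j → H j i ≡ true
  degR-witness H i pos = count-witness (λ j → H j i) (subst (0 <_) (degR≡count H i) pos)

  degL-witness : ∀ (H : Graph n d) j → 0 < degL H j → ∃ λ i → H j i ≡ true
  degL-witness H j pos = count-witness (H j) (subst (0 <_) (degL≡count H j) pos)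

  adj-sym : ∀ {H : Graph n d} x y → Adj H x y → Adj H y x
  adj-sym (inj₁ j) (inj₂ i) a = a
  adj-sym (inj₂ i) (inj₁ j) a = a

  adj-irrefl : ∀ {H : Graph n d} x y → Adj H x y → x ≢ y
  adj-irrefl (inj₁ j) (inj₂ i) a ()
  adj-irrefl (inj₂ i) (inj₁ j) a ()

  adj-mono : ∀ {G H : Graph n d} → G ⊑ H → ∀ x y → Adj G x y → Adj H x y
  adj-mono G⊑H (inj₁ j) (inj₂ i) a = G⊑H j i a
  adj-mono G⊑H (inj₂ i) (inj₁ j) a = G⊑H j i a

  chain-mono : ∀ {G H : Graph n d} → G ⊑ H → ∀ a xs b → Chain G a xs b → Chain H a xs b
  chain-mono G⊑H a [] b c = adj-mono G⊑H a b c
  chain-mono G⊑H a (y ∷ ys) b (c , cs) = adj-mono G⊑H a y c , chain-mono G⊑H y ys b cs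

  acyclic-mono : ∀ {G H : Graph n d} → G ⊑ H → Acyclic H → Acyclic G
  acyclic-mono G⊑H acH (x ∷ xs) (long , distinct , c) = acH (x ∷ xs) (long , distinct , chain-mono G⊑H x xs x c)

  -- A list of distinct vertices has at most n + d entries (pigeonhole via L ⊎ R ≅ Fin (n + d)).
  unique-length : (xs : List V) → Unique xs → length xs ≤ n + d
  unique-length xs u with length xs ≤? n + d
  ... | yes le = le
  ... | no nle with Fin.pigeonhole (≰⇒> nle) (join n d ∘ List.lookup xs)
  ...   | a , b , a<b , same = contradiction
          (trans (sym (Fin.splitAt-join n d _)) (trans (cong (splitAt n) same) (Fin.splitAt-join n d _)))
          (unique-lookup u a<b)

  -- Graphs without leaves contain cycles.

  Leafless : Graph n d → Set
  Leafless H = (∀ j → degL H j ≢ 1) × (∀ i → degR H i ≢ 1)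

  continue : ∀ {H : Graph n d} → Leafless H → ∀ x p → Adj H x p → ∃ λ y → Adj H x y × y ≢ p
  continue {H} (noLeafL , _) (inj₁ j) (inj₂ i) a
    with count-second i a (noLeafL j ∘ trans (degL≡count H j))
  ... | i′ , i′≢i , e = inj₂ i′ , e , i′≢i ∘ inj₂-injective
  continue {H} (_ , noLeafR) (inj₂ i) (inj₁ j) a
    with count-second j a (noLeafR i ∘ trans (degR≡count H i))
  ... | j′ , j′≢j , e = inj₁ j′ , e , j′≢j ∘ inj₁-injective

  prefix : ∀ {a : V} {xs : List V} → a ∈ₗ xs → List V
  prefix (here _) = []
  prefix {xs = x ∷ _} (there a∈) = x ∷ prefix a∈

  prefix-chain : ∀ {H : Graph n d} {a b x xs} → Adj H b x → Linked (Adj H) (x ∷ xs) →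
                 (a∈ : a ∈ₗ x ∷ xs) → Chain H b (prefix a∈) a
  prefix-chain b~x _ (here refl) = b~x
  prefix-chain b~x (x~y ∷ walk) (there a∈) = b~x , prefix-chain x~y walk a∈

  prefix-unique : ∀ {a} (xs : List V) (a∈ : a ∈ₗ xs) → Unique xs → Unique (a ∷ prefix a∈)
  prefix-unique (x ∷ xs) (here refl) _ = [] ∷ []
  prefix-unique (x ∷ xs) (there a∈) (x∉xs ∷ u) with prefix-unique xs a∈ u
  ... | a∉pre ∷ u′ = ((λ a≡x → All.lookup x∉xs a∈ (sym a≡x)) ∷ a∉pre) ∷ (restrict a∈ x∉xs ∷ u′)
    where
    restrict : ∀ {P : V → Set} {a} {ys : List V} (a∈ : a ∈ₗ ys) → All P ys → All P (prefix a∈)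
    restrict (here _) _ = []
    restrict (there a∈) (py ∷ pys) = py ∷ restrict a∈ pys

  -- Extend a non-backtracking walk x ∷ p ∷ r (most recent vertex first) with
  -- distinct vertices until the next step revisits it, which closes a cycle.
  -- The fuel f suffices because distinct vertices number at most n + d.
  grow : ∀ {H : Graph n d} → Leafless H → (f : ℕ) (x p : V) (r : List V) →
         Unique (x ∷ p ∷ r) → Linked (Adj H) (x ∷ p ∷ r) → n + d < length (x ∷ p ∷ r) + f →
         ∃ (IsCycle H)
  grow noLeaf zero x p r u walk bound =
    contradiction (unique-length _ u) (<⇒≱ (subst (n + d <_) (+-identityʳ _) bound))
  grow {H} noLeaf (suc f) x p r u walk bound with continue noLeaf x p (linked-head walk)
  ... | y , x~y , y≢p with y ∈? (x ∷ p ∷ r)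
  ...   | yes y∈ = y ∷ prefix y∈ , cycle-length y∈ , prefix-unique _ y∈ u ,
                   prefix-chain (adj-sym x y x~y) walk y∈
    where
    cycle-length : (y∈ : y ∈ₗ x ∷ p ∷ r) → 3 ≤ length (y ∷ prefix y∈)
    cycle-length (here y≡x) = contradiction (sym y≡x) (adj-irrefl x y x~y)
    cycle-length (there (here y≡p)) = contradiction y≡p y≢p
    cycle-length (there (there _)) = s≤s (s≤s (s≤s z≤n))
  ...   | no y∉ = grow noLeaf f y x (p ∷ r) (¬Any⇒All¬ _ y∉ ∷ u) (adj-sym x y x~y ∷ walk)
                    (subst (n + d <_) (+-suc _ f) bound)

  leafless-cycle : ∀ {H : Graph n d} j i → H j i ≡ true → Leafless H → ∃ (IsCycle H)
  leafless-cycle j i e noLeaf =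
    grow noLeaf (suc (n + d)) (inj₂ i) (inj₁ j) [] (((λ ()) ∷ []) ∷ [] ∷ []) (e ∷ [-])
      (m≤n+m (suc (n + d)) 2)

  leaf-edge : ∀ {H : Graph n d} j i → H j i ≡ true → Acyclic H →
              ∃ λ j′ → ∃ λ i′ → H j′ i′ ≡ true × (degL H j′ ≡ 1 ⊎ degR H i′ ≡ 1)
  leaf-edge {H} j i e acyclic with Fin.any? (λ j′ → degL H j′ ≟ 1) | Fin.any? (λ i′ → degR H i′ ≟ 1)
  ... | yes (j′ , leaf) | _ with degL-witness H j′ (subst (0 <_) (sym leaf) (s≤s z≤n))
  ...   | i′ , e′ = j′ , i′ , e′ , inj₁ leaf
  leaf-edge {H} j i e acyclic | _ | yes (i′ , leaf) with degR-witness H i′ (subst (0 <_) (sym leaf) (s≤s z≤n))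
  ... | j′ , e′ = j′ , i′ , e′ , inj₂ leaf
  leaf-edge j i e acyclic | no noLeafL | no noLeafR =
    ⊥-elim (acyclic _ (proj₂ (leafless-cycle j i e ((λ j′ l → noLeafL (j′ , l)) , (λ i′ l → noLeafR (i′ , l))))))

  -- Forests have more nodes than edges.

  -- Every edge is counted once at its right endpoint.
  edges : Graph n d → ℕ
  edges H = sumF (degR H)

  nodes : Graph n d → ℕ
  nodes H = sumF (occupied ∘ degL H) + sumF (occupied ∘ degR H)

  nodes-edge : ∀ {H : Graph n d} j i → H j i ≡ true → 2 ≤ nodes H
  nodes-edge {H} j i e =
    +-mono-≤ (occupied-sum-pos j (degL-pos H j i e)) (occupied-sum-pos i (degR-pos H j i e))

  delete : Graph n d → Fin n → Fin d → Graph n d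
  delete H j i j′ i′ = if does (j′ Fin.≟ j) ∧ does (i′ Fin.≟ i) then false else H j′ i′

  delete-⊑ : ∀ (H : Graph n d) j i → delete H j i ⊑ H
  delete-⊑ H j i j′ i′ e with j′ Fin.≟ j | i′ Fin.≟ i
  ... | yes _ | no _ = e
  ... | no _ | _ = e

  delete-self : ∀ (H : Graph n d) j i → delete H j i j i ≡ false
  delete-self H j i rewrite dec-true (j Fin.≟ j) refl | dec-true (i Fin.≟ i) refl = refl

  delete-other-row : ∀ (H : Graph n d) {j i j′} i′ → j′ ≢ j → delete H j i j′ i′ ≡ H j′ i′
  delete-other-row H {j} {i} {j′} i′ j′≢j with j′ Fin.≟ j
  ... | yes j′≡j = contradiction j′≡j j′≢j
  ... | no _ = refl

  delete-other-column : ∀ (H : Graph n d) {j i i′} j′ → i′ ≢ i → delete H j i j′ i′ ≡ H j′ i′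
  delete-other-column H {j} {i} {i′} j′ i′≢i with j′ Fin.≟ j | i′ Fin.≟ i
  ... | yes _ | yes i′≡i = contradiction i′≡i i′≢i
  ... | yes _ | no _ = refl
  ... | no _ | _ = refl

  degL-delete : ∀ (H : Graph n d) j i → H j i ≡ true → suc (degL (delete H j i) j) ≡ degL H j
  degL-delete H j i e rewrite degL≡count (delete H j i) j | degL≡count H j =
    sumF-bump i (subst₂ (λ a b → suc (χ a) ≡ χ b) (sym (delete-self H j i)) (sym e) refl)
      (λ i′ i′≢i → cong χ (delete-other-column H j i′≢i))

  degR-delete : ∀ (H : Graph n d) j i → H j i ≡ true → suc (degR (delete H j i) i) ≡ degR H i
  degR-delete H j i e rewrite degR≡count (delete H j i) i | degR≡count H i =
    sumF-bump j (subst₂ (λ a b → suc (χ a) ≡ χ b) (sym (delete-self H j i)) (sym e) refl)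
      (λ j′ j′≢j → cong χ (delete-other-row H i j′≢j))

  degR-delete-other : ∀ (H : Graph n d) j i i′ → i′ ≢ i → degR (delete H j i) i′ ≡ degR H i′
  degR-delete-other H j i i′ i′≢i rewrite degR≡count (delete H j i) i′ | degR≡count H i′ =
    sumF-cong (λ j′ → cong χ (delete-other-column H j′ i′≢i))

  edges-delete : ∀ (H : Graph n d) j i → H j i ≡ true → suc (edges (delete H j i)) ≡ edges H
  edges-delete H j i e = sumF-bump i (degR-delete H j i e) (degR-delete-other H j i)

  nodes-delete-leaf : ∀ (H : Graph n d) j i → H j i ≡ true → degL H j ≡ 1 ⊎ degR H i ≡ 1 →
                      nodes (delete H j i) < nodes H
  nodes-delete-leaf H j i e (inj₁ leaf) =
    +-mono-<-≤ (occupied-sum-< (degL-mono (delete-⊑ H j i)) j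
                  (suc-injective (trans (degL-delete H j i e) leaf)) leaf)
               (occupied-sum-mono (degR-mono (delete-⊑ H j i)))
  nodes-delete-leaf H j i e (inj₂ leaf) =
    +-mono-≤-< (occupied-sum-mono (degL-mono (delete-⊑ H j i)))
               (occupied-sum-< (degR-mono (delete-⊑ H j i)) i
                  (suc-injective (trans (degR-delete H j i e) leaf)) leaf)

  -- A forest with an edge has more nodes than edges: delete an edge at a leaf and induct.
  forest-edges< : ∀ e (H : Graph n d) → edges H ≡ e → Acyclic H → e ≡ 0 ⊎ e < nodes H
  forest-edges< zero H _ _ = inj₁ refl
  forest-edges< (suc e) H edges≡ acyclic
    with sumF-witness (degR H) (subst (0 <_) (sym edges≡) (s≤s z≤n))
  ... | i , degRi>0 with degR-witness H i degRi>0
  ...   | j , Hji with leaf-edge j i Hji acyclic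
  ...     | j′ , i′ , Hj′i′ , leaf
    with forest-edges< e (delete H j′ i′) (suc-injective (trans (edges-delete H j′ i′ Hj′i′) edges≡))
                       (acyclic-mono (delete-⊑ H j′ i′) acyclic)
  ... | inj₁ refl = inj₂ (nodes-edge j i Hji)
  ... | inj₂ e<nodes = inj₂ (≤-trans (s≤s e<nodes) (nodes-delete-leaf H j′ i′ Hj′i′ leaf))

  -- Subgraphs of a forest are determined by their degrees.

  infixl 30 _△_
  _△_ : Graph n d → Graph n d → Graph n d
  (G △ G′) j i = G j i xor G′ j i

  △-⊑ : ∀ {F G G′ : Graph n d} → G ⊑ F → G′ ⊑ F → G △ G′ ⊑ F
  △-⊑ {G = G} G⊑F G′⊑F j i e with G j i in Gji
  ... | true = G⊑F j i Gji
  ... | false = G′⊑F j i e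

  -- Graphs with equal degrees differ at every vertex by an even number of edges.
  △-leafless : ∀ {G G′ : Graph n d} → (∀ j → degL G j ≡ degL G′ j) → (∀ i → degR G i ≡ degR G′ i) →
               Leafless (G △ G′)
  △-leafless {G} {G′} sameL sameR =
    (λ j → count-xor≢1 (G j) (G′ j) (trans (sym (degL≡count G j)) (trans (sameL j) (degL≡count G′ j)))
           ∘ trans (sym (degL≡count (G △ G′) j))) ,
    (λ i → count-xor≢1 (λ j → G j i) (λ j → G′ j i)
             (trans (sym (degR≡count G i)) (trans (sameR i) (degR≡count G′ i)))
           ∘ trans (sym (degR≡count (G △ G′) i)))

  -- Subgraphs of a forest with the same degree sequences coincide, since otherwise
  -- their symmetric difference is a nonempty leafless subgraph, containing a cycle.
  forest-rigid : ∀ {F G G′ : Graph n d} → Acyclic F → G ⊑ F → G′ ⊑ F →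
                 (∀ j → degL G j ≡ degL G′ j) → (∀ i → degR G i ≡ degR G′ i) → ∀ j i → G j i ≡ G′ j i
  forest-rigid {G = G} {G′} acyclic G⊑F G′⊑F sameL sameR j i with G j i Data.Bool.≟ G′ j i
  ... | yes same = same
  ... | no differ with leafless-cycle j i (xor-differ differ) (△-leafless sameL sameR)
    where
    xor-differ : ∀ {a b} → a ≢ b → (a xor b) ≡ true
    xor-differ {true} {true} a≢b = contradiction refl a≢b
    xor-differ {true} {false} _ = refl
    xor-differ {false} {true} _ = refl
    xor-differ {false} {false} a≢b = contradiction refl a≢b
  ...   | cycle , isCycle = ⊥-elim (acyclic-mono (△-⊑ G⊑F G′⊑F) acyclic cycle isCycle)

open Graphs

remove-self : ∀ {m} (τ : Subset m) j → lookup (τ - j) j ≡ false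
remove-self (_ ∷ τ) zero = refl
remove-self (_ ∷ τ) (suc j) = remove-self τ j

remove-other : ∀ {m} (τ : Subset m) {j} j′ → j′ ≢ j → lookup (τ - j) j′ ≡ lookup τ j′
remove-other (_ ∷ τ) {zero} zero j′≢j = contradiction refl j′≢j
remove-other (_ ∷ τ) {zero} (suc j′) _ = cong (λ σ → lookup σ j′) (p─⊥≡p τ)
remove-other (_ ∷ τ) {suc j} zero _ = refl
remove-other (_ ∷ τ) {suc j} (suc j′) j′≢j = remove-other τ j′ (j′≢j ∘ cong suc)

card-remove : ∀ {m} (τ : Subset m) {j} → j ∈ τ → suc ∣ τ - j ∣ ≡ ∣ τ ∣
card-remove τ {j} j∈τ rewrite count-lookup (τ - j) | count-lookup τ =
  sumF-bump j (subst₂ (λ a b → suc (χ a) ≡ χ b) (sym (remove-self τ j)) (sym ([]=⇒lookup j∈τ)) refl)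
    (λ j′ j′≢j → cong χ (remove-other τ j′ j′≢j))

left-support : ∀ {n d} {G : Graph n d} {σ} → HasLeftDegree G σ → ∀ j i → G j i ≡ true → lookup σ j ≡ true
left-support {G = G} {σ} left j i e with lookup σ j | left j
... | true | _ = refl
... | false | degLj≡0 = contradiction (trans (sym degLj≡0) (degL≡count G j)) (<⇒≢ (count-pos i e))

left-outside : ∀ {n d} {G : Graph n d} {σ} → HasLeftDegree G σ → ∀ j i → lookup σ j ≡ false → G j i ≡ false
left-outside {G = G} {σ} left j i σj≡false with G j i in e
... | false = refl
... | true = contradiction (trans (sym (left-support {σ = σ} left j i e)) σj≡false) λ ()

allSubsets-complete : ∀ {m} (σ : Subset m) → σ ∈ₗ allSubsets m
allSubsets-complete [] = here refl
allSubsets-complete {suc m} (true ∷ σ) = ∈-++⁺ˡ (∈-map⁺ (true ∷_) (allSubsets-complete σ))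
allSubsets-complete {suc m} (false ∷ σ) =
  ∈-++⁺ʳ (List.map (true ∷_) (allSubsets m)) (∈-map⁺ (false ∷_) (allSubsets-complete σ))

contributes : ∀ {n d} → ℕ → (Subset n → Graph n d) → Subset n → Fin n → Fin d → Subset n → Bool
contributes k M τ j i σ = does (σ ⊆? τ) ∧ (∣ σ ∣ ≡ᵇ k) ∧ M σ j i

covector-intro : ∀ {n d} k (M : Subset n → Graph n d) τ {σ} j i → σ ⊆ τ → ∣ σ ∣ ≡ k → M σ j i ≡ true →
                 covector k M τ j i ≡ true
covector-intro k M τ {σ} j i σ⊆τ ∣σ∣≡k e = to T-≡ (any⁺ (contributes k M τ j i) (lose (allSubsets-complete σ)
  (from T-∧ (from T-≡ (dec-true (σ ⊆? τ) σ⊆τ) , from T-∧ (≡⇒≡ᵇ _ _ ∣σ∣≡k , from T-≡ e)))))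

covector-elim : ∀ {n d} k (M : Subset n → Graph n d) τ j i → covector k M τ j i ≡ true →
                ∃ λ σ → σ ⊆ τ × ∣ σ ∣ ≡ k × M σ j i ≡ true
covector-elim {n} k M τ j i e with satisfied (any⁻ (contributes k M τ j i) (allSubsets n) (from T-≡ e))
... | σ , holds with σ ⊆? τ
...   | no _ = ⊥-elim holds
...   | yes σ⊆τ with to T-∧ holds
...     | ∣σ∣≡k , Mσji = σ , σ⊆τ , ≡ᵇ⇒≡ _ _ ∣σ∣≡k , to T-≡ Mσji

module LinkageCovector {n d : ℕ} (v : Fin d → ℕ) (v>0 : ∀ i → 0 < v i)
  (M : Subset n → Graph n d) (topeField : IsTopeField v M) (linkage : IsLinkage v M)
  (τ : Subset n) (∣τ∣≡k+1 : ∣ τ ∣ ≡ suc (sumV v)) where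

  k : ℕ
  k = sumV v

  C : Graph n d
  C = covector k M τ

  acyclic : Acyclic C
  acyclic = proj₂ (linkage τ ∣τ∣≡k+1)

  τ-nonempty : ∃ λ j → j ∈ τ
  τ-nonempty with count-witness (lookup τ) (subst (0 <_) (trans (sym ∣τ∣≡k+1) (count-lookup τ)) (s≤s z≤n))
  ... | j , τj = j , lookup⇒[]= j τ τj

  -- Every edge of C is an edge of a tope of the field, hence starts in τ.
  C-rows : ∀ j i → C j i ≡ true → j ∈ τ
  C-rows j i e with covector-elim k M τ j i e
  ... | σ , σ⊆τ , ∣σ∣≡k , Mσji =
    σ⊆τ (lookup⇒[]= j σ (left-support {σ = σ} (proj₁ (proj₂ topeField σ ∣σ∣≡k)) j i Mσji))

  face-size : ∀ {j} → j ∈ τ → ∣ τ - j ∣ ≡ k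
  face-size j∈τ = suc-injective (trans (card-remove τ j∈τ) ∣τ∣≡k+1)

  face-tope : ∀ {j} → j ∈ τ → IsTope (M (τ - j)) (τ - j) v
  face-tope j∈τ = proj₂ topeField (τ - _) (face-size j∈τ)

  face-⊑ : ∀ {j} → j ∈ τ → M (τ - j) ⊑ C
  face-⊑ {j} j∈τ j′ i = covector-intro k M τ j′ i (p─q⊆p τ ⁅ j ⁆) (face-size j∈τ)

  face-degR : ∀ {j} → j ∈ τ → ∀ i → degR (M (τ - j)) i ≡ v i
  face-degR j∈τ = proj₁ (proj₂ (face-tope j∈τ))

  -- r_i has a neighbour ℓ_a in some face tope; M_{τ∖ℓ_a} ⊆ C has v_i edges at r_i but misses ℓ_a r_i.
  degR-lower : ∀ i → suc (v i) ≤ degR C i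
  degR-lower i with τ-nonempty
  ... | j₀ , j₀∈τ with degR-witness (M (τ - j₀)) i (subst (0 <_) (sym (face-degR j₀∈τ i)) (v>0 i))
  ...   | a , e = subst (_< degR C i) (face-degR a∈τ i) (degR-mono-< (face-⊑ a∈τ) a i missing Cai)
    where
    Cai : C a i ≡ true
    Cai = face-⊑ j₀∈τ a i e
    a∈τ : a ∈ τ
    a∈τ = C-rows a i Cai
    missing : M (τ - a) a i ≡ false
    missing = left-outside {σ = τ - a} (proj₁ (face-tope a∈τ)) a i (remove-self τ a)

  -- C has at most |τ| = k + 1 left nodes and d right nodes.
  nodes-upper : nodes C ≤ suc k + d
  nodes-upper = +-mono-≤
    (≤-trans (occupied-sum-≤ (lookup τ) left-nodes) (≤-reflexive (trans (sym (count-lookup τ)) ∣τ∣≡k+1)))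
    (≤-trans (occupied-sum-≤ {a = degR C} (λ _ → true) (λ _ _ → refl)) (≤-reflexive (count-all {d})))
    where
    left-nodes : ∀ j → 0 < degL C j → lookup τ j ≡ true
    left-nodes j pos = []=⇒lookup (C-rows j _ (proj₂ (degL-witness C j pos)))

  -- C is a forest, so it has fewer edges than nodes.
  edges-upper : edges C ≤ k + d
  edges-upper with forest-edges< (edges C) C refl acyclic
  ... | inj₁ none = ≤-trans (≤-reflexive none) z≤n
  ... | inj₂ fewer = ≤-pred (≤-trans fewer nodes-upper)

  -- Summing, Σ_i deg_C(r_i) ≤ k + d = Σ_i (v_i + 1), so every lower bound is attained.
  degR-exact : ∀ i → degR C i ≡ suc (v i)
  degR-exact = sumF-tight degR-lower (begin
    edges C        ≤⟨ edges-upper ⟩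
    k + d          ≡⟨ cong (_+ d) (sumV≡sumF v) ⟩
    sumF v + d     ≡⟨ sumF-suc v ⟨
    sumF (suc ∘ v) ∎)
    where open ≤-Reasoning

  -- A tope inside C with the data of M_{τ∖ℓ_j} has the same degrees, so by rigidity it is M_{τ∖ℓ_j}.
  face-unique : ∀ {j} → j ∈ τ → ∀ (G : Graph n d) → G ⊑ C → IsTope G (τ - j) v →
                ∀ j′ i → G j′ i ≡ M (τ - j) j′ i
  face-unique j∈τ G G⊑C (leftG , rightG , _) = forest-rigid acyclic G⊑C (face-⊑ j∈τ)
    (λ j′ → trans (leftG j′) (sym (proj₁ (face-tope j∈τ) j′)))
    (λ i → trans (rightG i) (sym (face-degR j∈τ i)))

lemma3p10 : ∀ {n d} → d ≤ n → (v : Fin d → ℕ) → (∀ i → 0 < v i) → sumV v < n →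
    (M : Subset n → Graph n d) → IsTopeField v M → IsLinkage v M →
    (τ : Subset n) → ∣ τ ∣ ≡ suc (sumV v) →
    (∀ (i : Fin d) → degR (covector (sumV v) M τ) i ≡ suc (v i))
    × (∀ (j : Fin n) → j ∈ τ →
        (M (τ - j) ⊑ covector (sumV v) M τ × IsTope (M (τ - j)) (τ - j) v)
        × (∀ (G : Graph n d) → G ⊑ covector (sumV v) M τ → IsTope G (τ - j) v →
             ∀ j′ i → G j′ i ≡ M (τ - j) j′ i))
lemma3p10 _ v v>0 _ M topeField linkage τ ∣τ∣≡k+1 =
  degR-exact , λ j j∈τ → (face-⊑ j∈τ , face-tope j∈τ) , face-unique j∈τ
  where open LinkageCovector v v>0 M topeField linkage τ ∣τ∣≡k+1
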